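{- Let $1\le \ell\le n$, let $I$ and $J$ be the $n\times n$ identity and all-ones matrices, and let $s,t$ be scalars (or indeterminates). Then $$(sI+tJ)^{\vee\ell}=\sum_{k}\sum_{j=k}^{\ell}\binom{\ell-k}{\ell-j}\,j!\,s^{\ell-j}t^{j}\,\mathrm{JS}^{n\ell}_{k}=\sum_{k} h_{\ell-k,k}(s,t)\,\mathrm{JS}^{n\ell}_{k},$$ where $k$ ranges over $0\le k\le \min(\ell,n-\ell)$.
   Context: For an $n\times n$ matrix $Y$, $Y^{\vee\ell}$ is the $\binom n\ell\times\binom n\ell$ matrix indexed by $\ell$-subsets of $[n]=\{1,\dots,n\}$ whose $(\mathrm{S},\mathrm{T})$ entry is the permanent of the submatrix of $Y$ with rows $\mathrm{S}$ and columns $\mathrm{T}$. The Johnson distance between $\ell$-subsets is $\mathrm{dist}(\mathrm{S},\mathrm{T})=|\mathrm{S}\setminus\mathrm{T}|$, and $\mathrm{JS}^{n\ell}_k$ is the $\binom n\ell\times\binom n\ell$ $0$-$1$ matrix indexed by $\ell$-subsets with $(\mathrm{S},\mathrm{T})$ entry $1$ iff $\mathrm{dist}(\mathrm{S},\mathrm{T})=k$. The exponential moment polynomials are $h_{a,b}(x,t)=\int_0^\infty (x+ty)^a(ty)^b e^{ -y}\,dy=\sum_{j=0}^a\binom aj (b+j)!\,x^{a-j}t^{b+j}$. -}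

module Defs where

open import Level using (Level)
open import Data.Nat using (ℕ; zero; suc; _∸_; _⊔_; _⊓_; _!)
open import Data.Nat.Combinatorics using (_C_)
open import Data.Bool using (Bool; true; false)
open import Data.Fin using (Fin; zero; suc; _≟_)
open import Data.Fin.Properties using (all?)
open import Data.Fin.Subset using (Subset; ∣_∣; _─_)
open import Data.Vec using (Vec; []; _∷_)
open import Data.List using (List; []; _∷_; map; concatMap; foldr; filter; allFin; upTo; length)
open import Data.Product using (Σ; _,_; proj₁)
open import Relation.Binary.PropositionalEquality using (_≡_)
open import Relation.Nullary using (Dec; yes; no; _→-dec_)
open import Algebra.Bundles using (CommutativeRing)
import Algebra.Bundles

members : ∀ {n} → Subset n → List (Fin n)
members {zero}  []           = []
members {suc n} (true  ∷ p)  = zero ∷ map suc (members p)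
members {suc n} (false ∷ p)  = map suc (members p)

dist : ∀ {n} → Subset n → Subset n → ℕ
dist S T = ∣ S ─ T ∣

LSub : ℕ → ℕ → Set
LSub n ℓ = Σ (Subset n) (λ S → ∣ S ∣ ≡ ℓ)

allFuncs : (r c : ℕ) → List (Fin r → Fin c)
allFuncs zero    c = (λ ()) ∷ []
allFuncs (suc r) c =
  concatMap (λ j → map (λ f → λ { zero → j ; (suc i) → f i }) (allFuncs r c)) (allFin c)

InjectiveFin : ∀ {r c} → (Fin r → Fin c) → Set
InjectiveFin f = ∀ i j → f i ≡ f j → i ≡ j

injectiveFin? : ∀ {r c} (f : Fin r → Fin c) → Dec (InjectiveFin f)
injectiveFin? f = all? (λ i → all? (λ j → (f i ≟ f j) →-dec (i ≟ j)))

injections : (r c : ℕ) → List (Fin r → Fin c)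
injections r c = filter injectiveFin? (allFuncs r c)

module Mat {a ℓ' : Level} (R : CommutativeRing a ℓ') where
  open CommutativeRing R public
  open import Algebra.Definitions.RawSemiring (Algebra.Bundles.CommutativeSemiring.rawSemiring commutativeSemiring) public using (_^_) renaming (_×_ to _·ₙ_)

  ΣL : ∀ {X : Set} → List X → (X → Carrier) → Carrier
  ΣL xs f = foldr (λ x acc → f x + acc) 0# xs

  ΠF : ∀ {r} → (Fin r → Carrier) → Carrier
  ΠF f = foldr (λ i acc → f i * acc) 1# (allFin _)

  -- Σ_{i=lo}^{hi} f i  (empty if hi < lo)
  ΣR : ℕ → ℕ → (ℕ → Carrier) → Carrier
  ΣR lo hi f = ΣL (map (λ i → lo Data.Nat.+ i) (upTo (suc hi ∸ lo))) f

  -- permanent of an r×c matrix: sum over injections Fin r → Fin c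
  -- (for square matrices: the sum over all permutations)
  perm : ∀ {r c} → (Fin r → Fin c → Carrier) → Carrier
  perm {r} {c} M = ΣL (injections r c) (λ σ → ΠF (λ i → M i (σ i)))

  Matrix : ℕ → Set a
  Matrix n = Fin n → Fin n → Carrier

  idM : ∀ {n} → Matrix n
  idM i j with i ≟ j
  ... | yes _ = 1#
  ... | no  _ = 0#

  onesM : ∀ {n} → Matrix n
  onesM i j = 1#

  -- Y^{∨ℓ}: (S,T) entry = permanent of submatrix with rows S, columns T
  compound : ∀ {n} (ℓ : ℕ) → Matrix n → LSub n ℓ → LSub n ℓ → Carrier
  compound ℓ Y (S , _) (T , _) =
    perm {length (members S)} {length (members T)}
         (λ i j → Y (Data.List.lookup (members S) i) (Data.List.lookup (members T) j))

  JS : ∀ n ℓ → ℕ → LSub n ℓ → LSub n ℓ → Carrier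
  JS n ℓ k (S , _) (T , _) with dist S T Data.Nat.≟ k
  ... | yes _ = 1#
  ... | no  _ = 0#

  h : ℕ → ℕ → Carrier → Carrier → Carrier
  h a b x t = ΣR 0 a (λ j → ((a C j) Data.Nat.* ((b Data.Nat.+ j) !)) ·ₙ ((x ^ (a ∸ j)) * (t ^ (b Data.Nat.+ j))))

  lincomb : ∀ {n ℓ} → ℕ → (ℕ → Carrier) → (ℕ → LSub n ℓ → LSub n ℓ → Carrier)
          → LSub n ℓ → LSub n ℓ → Carrier
  lincomb K c M S T = ΣR 0 K (λ k → c k * M k S T)

  _≋_ : ∀ {n ℓ} → (LSub n ℓ → LSub n ℓ → Carrier) → (LSub n ℓ → LSub n ℓ → Carrier) → Set ℓ'
  A ≋ B = ∀ S T → A S T ≈ B S T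

module Submission where

-- Write Y = sI + tJ and let S, T be ℓ-subsets at Johnson distance d. Expanding the permanent
-- of Y[S,T] along its rows, every row x contributes t to each free column and, when x ∈ T,
-- an additional s to column x. For r remaining rows, m free columns and p rows whose own
-- column is still free, the row expansion equals
--   Σ_q C(p,q) (m−q)(m−q−1)⋯(m−r+1) s^q t^(r−q),
-- choosing the q rows that take their s-entry and placing the others injectively. Both row
-- cases are Pascal-type recurrences of this formula; the t-part of a row is evaluated by
-- counting, for each placement of the remaining rows, the free columns it leaves over.
-- Starting from r = m = ℓ and p = |S ∩ T| = ℓ − d, reversing the sum gives h_{ℓ−d,d}(s,t),
-- which depends on (S,T) only through d.

open import Defs
open import Level using (Level)
open import Algebra.Bundles using (CommutativeRing)
open import Data.Bool using (Bool; true; false; not; _∧_; _∨_; if_then_else_)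
open import Data.Bool.Properties using (∨-assoc; ∨-comm; T-≡)
import Data.Bool.Properties as Bool
open import Data.Empty using (⊥-elim)
open import Data.Fin using (Fin; zero; suc; _≟_; toℕ; inject₁; fromℕ; fromℕ<; opposite)
open import Data.Fin.Properties
  using (suc-injective; 0≢1+n; punchInᵢ≢i; toℕ<n; toℕ-inject₁; toℕ-fromℕ; toℕ-fromℕ<; toℕ-injective; opposite-prop; any?)
open import Data.Fin.Permutation using (reverse)
open import Data.Fin.Subset using (Subset; ∣_∣)
open import Data.List
  using (List; []; _∷_; _++_; length; lookup; map; concatMap; filter; tabulate; applyUpTo; upTo; foldr; allFin)
open import Data.List.Properties
  using (length-map; foldr-map; map-tabulate; length-filter; filter-accept; filter-reject; filter-≐)
open import Data.List.Membership.Propositional using (_∈_; _∉_)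
open import Data.List.Membership.Propositional.Properties using (∈-lookup)
open import Data.List.Relation.Unary.All as All using (All; []; _∷_)
import Data.List.Relation.Unary.All.Properties as All
open import Data.List.Relation.Unary.AllPairs using ([]; _∷_)
open import Data.List.Relation.Unary.Any as Any using (here; there)
open import Data.List.Relation.Unary.Any.Properties as Any using (lookup-index)
open import Data.List.Relation.Unary.Unique.Propositional using (Unique)
import Data.List.Relation.Unary.Unique.Propositional.Properties as Unique
open import Data.Nat using (ℕ; _≤_; _∸_; _⊓_; _!)
import Data.Nat as ℕ
open import Data.Nat.Combinatorics using (_C_; nCk+nC[k+1]≡[n+1]C[k+1]; nCk≡nC[n∸k])
open import Data.Nat.Combinatorics.Base using (_P′_)
open import Data.Nat.Combinatorics.Specification using (k>n⇒nCk≡0; nP′n≡n!)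
open import Data.Nat.Properties as ℕₚ using ()
import Algebra.Properties.CommutativeSemigroup ℕₚ.*-commutativeSemigroup as ℕ*
open import Data.Product using (_×_; _,_; proj₁; proj₂; ∃-syntax)
open import Data.Vec as V using ([]; _∷_)
open import Data.Vec.Functional using (removeAt)
open import Function using (_∘_)
open import Function.Bundles using (Equivalence; _⇔_; mk⇔)
open import Function.Construct.Composition using (_⇔-∘_)
open import Relation.Binary.PropositionalEquality as ≡ using (_≡_; _≢_)
open import Relation.Nullary using (Dec; does; proof; yes; no)
open import Relation.Nullary.Decidable using (dec-true; dec-false; _×-dec_)
import Relation.Nullary.Reflects as Reflects
open import Relation.Unary using (Decidable)

[m∸n]∸[o∸n]≡m∸o : ∀ m {n o} → n ≤ o → (m ∸ n) ∸ (o ∸ n) ≡ m ∸ o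
[m∸n]∸[o∸n]≡m∸o m {n} n≤o = ≡.trans (ℕₚ.∸-+-assoc m n _) (≡.cong (m ∸_) (ℕₚ.m+[n∸m]≡n n≤o))

m∸[m∸n∸o]≡n+o : ∀ {m n o} → n ≤ m → o ≤ m ∸ n → m ∸ (m ∸ n ∸ o) ≡ n ℕ.+ o
m∸[m∸n∸o]≡n+o {m} {n} {o} n≤m o≤m∸n = ≡.trans (≡.cong (m ∸_) (ℕₚ.∸-+-assoc m n o))
  (ℕₚ.m∸[m∸n]≡n (≡.subst (_≤ m) (ℕₚ.+-comm o n) (ℕₚ.m≤o∸n⇒m+n≤o o n≤m o≤m∸n)))

length-filter-cong : ∀ {X : Set} {P Q : X → Set} (P? : Decidable P) (Q? : Decidable Q) {xs} →
                     All (λ x → (P x → Q x) × (Q x → P x)) xs → length (filter P? xs) ≡ length (filter Q? xs)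
length-filter-cong P? Q? [] = ≡.refl
length-filter-cong P? Q? {x ∷ xs} ((P⇒Q , Q⇒P) ∷ rest) with P? x | Q? x
... | yes _ | yes _ = ≡.cong ℕ.suc (length-filter-cong P? Q? rest)
... | no _ | no _ = length-filter-cong P? Q? rest
... | yes p | no ¬q = ⊥-elim (¬q (P⇒Q p))
... | no ¬p | yes q = ⊥-elim (¬p (Q⇒P q))

length-filter-map : ∀ {X Y : Set} {P : Y → Set} (P? : Decidable P) (f : X → Y) xs →
                    length (filter P? (map f xs)) ≡ length (filter (P? ∘ f) xs)
length-filter-map P? f [] = ≡.refl
length-filter-map P? f (x ∷ xs) with does (P? (f x))
... | true = ≡.cong ℕ.suc (length-filter-map P? f xs)
... | false = length-filter-map P? f xs

Unique⇒lookup-injective : ∀ {X : Set} {xs : List X} → Unique xs → ∀ {j j'} → lookup xs j ≡ lookup xs j' → j ≡ j'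
Unique⇒lookup-injective (_ ∷ _) {zero} {zero} _ = ≡.refl
Unique⇒lookup-injective (x∉xs ∷ _) {zero} {suc j'} eq = ⊥-elim (All.lookup x∉xs (∈-lookup j') eq)
Unique⇒lookup-injective (x∉xs ∷ _) {suc j} {zero} eq = ⊥-elim (All.lookup x∉xs (∈-lookup j) (≡.sym eq))
Unique⇒lookup-injective (_ ∷ xs-unique) {suc j} {suc j'} eq = ≡.cong suc (Unique⇒lookup-injective xs-unique eq)

-- Column masks: `A j ≡ true` means that column j is already taken.
use : ∀ {c} → (Fin c → Bool) → Fin c → Fin c → Bool
use A j x = does (x ≟ j) ∨ A x

module _ {c} (A : Fin c → Bool) where

  use-self : ∀ j → use A j j ≡ true
  use-self j = ≡.cong (_∨ A j) (dec-true (j ≟ j) ≡.refl)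

  use-other : ∀ {j x} → x ≢ j → use A j x ≡ A x
  use-other {j} {x} x≢j = ≡.cong (_∨ A x) (dec-false (x ≟ j) x≢j)

  use≡false : ∀ {j x} → use A j x ≡ false → x ≢ j × A x ≡ false
  use≡false {j} {x} e with x ≟ j
  ... | no x≢j = x≢j , e

  use-comm : ∀ j j' x → use (use A j) j' x ≡ use (use A j') j x
  use-comm j j' x = begin
    does (x ≟ j') ∨ (does (x ≟ j) ∨ A x) ≡⟨ ≡.sym (∨-assoc (does (x ≟ j')) _ _) ⟩
    (does (x ≟ j') ∨ does (x ≟ j)) ∨ A x ≡⟨ ≡.cong (_∨ A x) (∨-comm (does (x ≟ j')) _) ⟩
    (does (x ≟ j) ∨ does (x ≟ j')) ∨ A x ≡⟨ ∨-assoc (does (x ≟ j)) _ _ ⟩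
    does (x ≟ j) ∨ (does (x ≟ j') ∨ A x) ∎
    where open ≡.≡-Reasoning

#free : ∀ {c} → (Fin c → Bool) → ℕ
#free {ℕ.zero} A = 0
#free {ℕ.suc c} A = (if A zero then 0 else 1) ℕ.+ #free (A ∘ suc)

#free-none : ∀ c → #free {c} (λ _ → false) ≡ c
#free-none ℕ.zero = ≡.refl
#free-none (ℕ.suc c) = ≡.cong ℕ.suc (#free-none c)

#free-use : ∀ {c} (A : Fin c → Bool) j → A j ≡ false → #free A ≡ ℕ.suc (#free (use A j))
#free-use A zero e rewrite e = ≡.refl
#free-use A (suc j) e = ≡.trans (≡.cong ((if A zero then 0 else 1) ℕ.+_) (#free-use (A ∘ suc) j e))
                                (ℕₚ.+-suc _ _)

injectiveAvoiding : ∀ {r c} → (Fin c → Bool) → (Fin r → Fin c) → Bool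
injectiveAvoiding {ℕ.zero} A σ = true
injectiveAvoiding {ℕ.suc r} A σ = not (A (σ zero)) ∧ injectiveAvoiding (use A (σ zero)) (σ ∘ suc)

injectiveAvoiding-sound : ∀ {r c} (A : Fin c → Bool) (σ : Fin r → Fin c) → injectiveAvoiding A σ ≡ true →
                          InjectiveFin σ × (∀ i → A (σ i) ≡ false)
injectiveAvoiding-sound {ℕ.zero} A σ _ = (λ ()) , (λ ())
injectiveAvoiding-sound {ℕ.suc r} A σ e with A (σ zero) in σ₀-free
... | false with injectiveAvoiding-sound (use A (σ zero)) (σ ∘ suc) e
...   | σ₊-injective , σ₊-avoids = injective , avoids
  where
  injective : InjectiveFin σ
  injective zero zero _ = ≡.refl
  injective zero (suc j) eq = ⊥-elim (proj₁ (use≡false A (σ₊-avoids j)) (≡.sym eq))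
  injective (suc i) zero eq = ⊥-elim (proj₁ (use≡false A (σ₊-avoids i)) eq)
  injective (suc i) (suc j) eq = ≡.cong suc (σ₊-injective i j eq)
  avoids : ∀ i → A (σ i) ≡ false
  avoids zero = σ₀-free
  avoids (suc i) = proj₂ (use≡false A (σ₊-avoids i))

injectiveAvoiding-complete : ∀ {r c} (A : Fin c → Bool) (σ : Fin r → Fin c) →
                             InjectiveFin σ → (∀ i → A (σ i) ≡ false) → injectiveAvoiding A σ ≡ true
injectiveAvoiding-complete {ℕ.zero} A σ _ _ = ≡.refl
injectiveAvoiding-complete {ℕ.suc r} A σ injective avoids rewrite avoids zero =
  injectiveAvoiding-complete (use A (σ zero)) (σ ∘ suc)
    (λ i j eq → suc-injective (injective (suc i) (suc j) eq))
    (λ i → ≡.trans (use-other A (λ eq → 0≢1+n (≡.sym (injective (suc i) zero eq)))) (avoids (suc i)))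

does-injectiveFin? : ∀ {r c} (σ : Fin r → Fin c) → does (injectiveFin? σ) ≡ injectiveAvoiding (λ _ → false) σ
does-injectiveFin? σ = Reflects.det (proof (injectiveFin? σ)) (Reflects.fromEquivalence
  (λ t → proj₁ (injectiveAvoiding-sound _ σ (Equivalence.to T-≡ t)))
  (λ injective → Equivalence.from T-≡ (injectiveAvoiding-complete _ σ injective (λ _ → ≡.refl))))

module _ {n c} (y : Fin c → Fin n) where

  Matched : (Fin c → Bool) → Fin n → Set
  Matched A x = ∃[ j ] (A j ≡ false × x ≡ y j)

  matched? : ∀ A → Decidable (Matched A)
  matched? A x = any? (λ j → (A j Bool.≟ false) ×-dec (x ≟ y j))

  #matched : (Fin c → Bool) → List (Fin n) → ℕ
  #matched A xs = length (filter (matched? A) xs)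

  #matched-use : ∀ {A j x} xs → x ≡ y j → All (x ≢_) xs → #matched (use A j) xs ≡ #matched A xs
  #matched-use {A} {j} {x} xs x≡yj x∉xs = length-filter-cong (matched? (use A j)) (matched? A) (All.map equiv x∉xs)
    where
    equiv : ∀ {x'} → x ≢ x' → (Matched (use A j) x' → Matched A x') × (Matched A x' → Matched (use A j) x')
    equiv {x'} x≢x' = (λ (j' , free , x'≡yj') → j' , proj₂ (use≡false A free) , x'≡yj')
                    , (λ (j' , free , x'≡yj') → j' , ≡.trans (use-other A (j'≢j x'≡yj')) free , x'≡yj')
      where
      j'≢j : ∀ {j'} → x' ≡ y j' → j' ≢ j
      j'≢j x'≡yj' ≡.refl = x≢x' (≡.trans x≡yj (≡.sym x'≡yj'))

length-members : ∀ {n} (S : Subset n) → length (members S) ≡ ∣ S ∣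
length-members {ℕ.zero} [] = ≡.refl
length-members {ℕ.suc n} (true ∷ S) = ≡.cong ℕ.suc (≡.trans (length-map suc (members S)) (length-members S))
length-members {ℕ.suc n} (false ∷ S) = ≡.trans (length-map suc (members S)) (length-members S)

members-unique : ∀ {n} (S : Subset n) → Unique (members S)
members-unique {ℕ.zero} [] = []
members-unique {ℕ.suc n} (true ∷ S) = All.map⁺ (All.universal (λ _ ()) (members S)) ∷ Unique.map⁺ suc-injective (members-unique S)
members-unique {ℕ.suc n} (false ∷ S) = Unique.map⁺ suc-injective (members-unique S)

suc∈map-suc : ∀ {n} {x : Fin n} {xs} → suc x ∈ map suc xs ⇔ x ∈ xs
suc∈map-suc = mk⇔ (Any.map suc-injective ∘ Any.map⁻) (Any.map⁺ ∘ Any.map (≡.cong suc))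

zero∉map-suc : ∀ {n} {xs : List (Fin n)} → zero ∉ map suc xs
zero∉map-suc {xs = _ ∷ _} (here ())
zero∉map-suc {xs = _ ∷ _} (there p) = zero∉map-suc p

∈-members : ∀ {n} (T : Subset n) x → x ∈ members T ⇔ V.lookup T x ≡ true
∈-members (true ∷ T) zero = mk⇔ (λ _ → ≡.refl) (λ _ → here ≡.refl)
∈-members (true ∷ T) (suc x) = mk⇔ (λ { (here ()) ; (there p) → Equivalence.to (∈-members T x) (Equivalence.to suc∈map-suc p) })
                                   (there ∘ Equivalence.from suc∈map-suc ∘ Equivalence.from (∈-members T x))
∈-members (false ∷ T) zero = mk⇔ (⊥-elim ∘ zero∉map-suc) (λ ())
∈-members (false ∷ T) (suc x) = ∈-members T x ⇔-∘ suc∈map-suc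

common+dist≡∣S∣ : ∀ {n} (S T : Subset n) →
                  length (filter (λ x → V.lookup T x Bool.≟ true) (members S)) ℕ.+ dist S T ≡ ∣ S ∣
common+dist≡∣S∣ [] [] = ≡.refl
common+dist≡∣S∣ (true ∷ S) (true ∷ T) =
  ≡.cong ℕ.suc (≡.trans (≡.cong (ℕ._+ dist S T) (length-filter-map _ suc (members S))) (common+dist≡∣S∣ S T))
common+dist≡∣S∣ (true ∷ S) (false ∷ T) =
  ≡.trans (≡.cong (ℕ._+ ℕ.suc (dist S T)) (length-filter-map _ suc (members S)))
          (≡.trans (ℕₚ.+-suc _ _) (≡.cong ℕ.suc (common+dist≡∣S∣ S T)))
common+dist≡∣S∣ (false ∷ S) (true ∷ T) =
  ≡.trans (≡.cong (ℕ._+ dist S T) (length-filter-map _ suc (members S))) (common+dist≡∣S∣ S T)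
common+dist≡∣S∣ (false ∷ S) (false ∷ T) =
  ≡.trans (≡.cong (ℕ._+ dist S T) (length-filter-map _ suc (members S))) (common+dist≡∣S∣ S T)

dist+∣T∣≤n : ∀ {n} (S T : Subset n) → dist S T ℕ.+ ∣ T ∣ ≤ n
dist+∣T∣≤n [] [] = ℕ.z≤n
dist+∣T∣≤n {ℕ.suc n} (_ ∷ S) (true ∷ T) = ≡.subst (_≤ ℕ.suc n) (≡.sym (ℕₚ.+-suc _ _)) (ℕ.s≤s (dist+∣T∣≤n S T))
dist+∣T∣≤n (true ∷ S) (false ∷ T) = ℕ.s≤s (dist+∣T∣≤n S T)
dist+∣T∣≤n (false ∷ S) (false ∷ T) = ℕₚ.m≤n⇒m≤1+n (dist+∣T∣≤n S T)

#matched-members : ∀ {n} (S T : Subset n) → #matched (lookup (members T)) (λ _ → false) (members S) ℕ.+ dist S T ≡ ∣ S ∣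
#matched-members {n} S T = ≡.trans
  (≡.cong (λ xs → length xs ℕ.+ dist S T) (filter-≐ (matched? y _) (λ x → V.lookup T x Bool.≟ true) (to , from) (members S)))
  (common+dist≡∣S∣ S T)
  where
  y : Fin (length (members T)) → Fin n
  y = lookup (members T)
  to : ∀ {x} → Matched y (λ _ → false) x → V.lookup T x ≡ true
  to {x} (j , _ , x≡yj) = Equivalence.to (∈-members T x) (≡.subst (_∈ members T) (≡.sym x≡yj) (∈-lookup j))
  from : ∀ {x} → V.lookup T x ≡ true → Matched y (λ _ → false) x
  from {x} x∈T = let x∈members = Equivalence.from (∈-members T x) x∈T in Any.index x∈members , ≡.refl , lookup-index x∈members

dist≤∣S∣ : ∀ {n} (S T : Subset n) → dist S T ≤ ∣ S ∣
dist≤∣S∣ S T = ≡.subst (dist S T ≤_) (common+dist≡∣S∣ S T) (ℕₚ.m≤n+m (dist S T) _)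

dist≤ℓ⊓[n∸ℓ] : ∀ {n ℓ} (S T : LSub n ℓ) → dist (proj₁ S) (proj₁ T) ≤ ℓ ⊓ (n ∸ ℓ)
dist≤ℓ⊓[n∸ℓ] {n} (S , ∣S∣≡ℓ) (T , ∣T∣≡ℓ) = ℕₚ.⊓-glb
  (≡.subst (dist S T ≤_) ∣S∣≡ℓ (dist≤∣S∣ S T))
  (ℕₚ.m+n≤o⇒m≤o∸n (dist S T) (≡.subst (λ k → dist S T ℕ.+ k ≤ n) ∣T∣≡ℓ (dist+∣T∣≤n S T)))

module _ {a ℓ'} (R : CommutativeRing a ℓ') where
  open Mat R hiding (zero)
  open import Algebra.Properties.Semiring.Sum semiring
    using (sum; sum-syntax; sum-cong-≋; sum-replicate; sum-replicate-zero; sum-remove; ∑-distrib-+; ∑-comm; *-distribˡ-sum; sum-init-last; ∑-permute)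
  open import Algebra.Properties.CommutativeMonoid.Mult +-commutativeMonoid using (×-distrib-+)
  open import Algebra.Properties.Semiring.Mult semiring using (×-comm-*; ×-assocˡ; ×-congʳ; ×-homo-+)
  open import Algebra.Properties.CommutativeSemigroup *-commutativeSemigroup as R* using ()
  open import Algebra.Properties.CommutativeSemigroup +-commutativeSemigroup as R+ using ()
  open import Relation.Binary.Reasoning.Setoid setoid

  ∑-zero : ∀ {n} (f : Fin n → Carrier) → (∀ i → f i ≈ 0#) → sum f ≈ 0#
  ∑-zero {n} f f≈0 = trans (sum-cong-≋ f≈0) (sum-replicate-zero n)

  ∑-delta : ∀ {n} (f : Fin n → Carrier) i → (∀ j → j ≢ i → f j ≈ 0#) → sum f ≈ f i
  ∑-delta {ℕ.suc n} f i f≈0 = begin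
    sum f                         ≈⟨ sum-remove {i = i} f ⟩
    f i + sum (removeAt f i)      ≈⟨ +-congˡ (∑-zero (removeAt f i) (λ j → f≈0 _ (punchInᵢ≢i i j))) ⟩
    f i + 0#                      ≈⟨ +-identityʳ (f i) ⟩
    f i                           ∎

  ×-zeroʳ : ∀ k → k ·ₙ 0# ≈ 0#
  ×-zeroʳ k = trans (sym (sum-replicate k)) (sum-replicate-zero k)

  ×-distrib-sum : ∀ {n} k (f : Fin n → Carrier) → k ·ₙ sum f ≈ ∑[ i < n ] (k ·ₙ f i)
  ×-distrib-sum {ℕ.zero} k f = ×-zeroʳ k
  ×-distrib-sum {ℕ.suc n} k f = trans (×-distrib-+ _ _ k) (+-congˡ (×-distrib-sum k (f ∘ suc)))

  ∑-if : ∀ {n} b (f : Fin n → Carrier) → ∑[ j < n ] (if b then 0# else f j) ≈ (if b then 0# else sum f)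
  ∑-if {n} true f = ∑-zero {n} _ (λ _ → refl)
  ∑-if false f = refl

  if-cong : ∀ b {x y} → x ≈ y → (if b then 0# else x) ≈ (if b then 0# else y)
  if-cong true _ = refl
  if-cong false x≈y = x≈y

  ΣL-cong : ∀ {X : Set} (xs : List X) {f g : X → Carrier} → (∀ x → f x ≈ g x) → ΣL xs f ≈ ΣL xs g
  ΣL-cong [] _ = refl
  ΣL-cong (x ∷ xs) f≈g = +-cong (f≈g x) (ΣL-cong xs f≈g)

  ΣL-++ : ∀ {X : Set} (xs ys : List X) f → ΣL (xs ++ ys) f ≈ ΣL xs f + ΣL ys f
  ΣL-++ [] ys f = sym (+-identityˡ _)
  ΣL-++ (x ∷ xs) ys f = trans (+-congˡ (ΣL-++ xs ys f)) (sym (+-assoc _ _ _))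

  ΣL-concatMap : ∀ {X Y : Set} (F : X → List Y) xs f → ΣL (concatMap F xs) f ≈ ΣL xs (λ x → ΣL (F x) f)
  ΣL-concatMap F [] f = refl
  ΣL-concatMap F (x ∷ xs) f = trans (ΣL-++ (F x) (concatMap F xs) f) (+-congˡ (ΣL-concatMap F xs f))

  ΣL-map : ∀ {X Y : Set} (g : X → Y) xs f → ΣL (map g xs) f ≡ ΣL xs (f ∘ g)
  ΣL-map g xs f = foldr-map _ g 0# xs

  ΣL-tabulate : ∀ {X : Set} {n} (g : Fin n → X) f → ΣL (tabulate g) f ≡ ∑[ i < n ] f (g i)
  ΣL-tabulate {n = ℕ.zero} g f = ≡.refl
  ΣL-tabulate {n = ℕ.suc n} g f = ≡.cong (f (g zero) +_) (ΣL-tabulate (g ∘ suc) f)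

  ΣL-filter : ∀ {X : Set} {P : X → Set} (P? : Decidable P) xs f →
              ΣL (filter P? xs) f ≈ ΣL xs (λ x → if does (P? x) then f x else 0#)
  ΣL-filter P? [] f = refl
  ΣL-filter P? (x ∷ xs) f with does (P? x)
  ... | true = +-congˡ (ΣL-filter P? xs f)
  ... | false = trans (ΣL-filter P? xs f) (sym (+-identityˡ _))

  ΣL-if : ∀ {X : Set} (xs : List X) b x g → ΣL xs (λ z → if b then 0# else x * g z) ≈ (if b then 0# else x * ΣL xs g)
  ΣL-if [] true x g = refl
  ΣL-if (_ ∷ xs) true x g = trans (+-identityˡ _) (ΣL-if xs true x g)
  ΣL-if [] false x g = sym (zeroʳ x)
  ΣL-if (_ ∷ xs) false x g = trans (+-congˡ (ΣL-if xs false x g)) (sym (distribˡ x _ _))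

  ΣL-applyUpTo : ∀ {X : Set} N (g : ℕ → X) f → ΣL (applyUpTo g N) f ≡ ∑[ i < N ] f (g (toℕ i))
  ΣL-applyUpTo ℕ.zero g f = ≡.refl
  ΣL-applyUpTo (ℕ.suc N) g f = ≡.cong (f (g 0) +_) (ΣL-applyUpTo N (g ∘ ℕ.suc) f)

  ΣR-∑ : ∀ lo hi f → ΣR lo hi f ≡ ∑[ i < ℕ.suc hi ∸ lo ] f (lo ℕ.+ toℕ i)
  ΣR-∑ lo hi f = ≡.trans (ΣL-map (lo ℕ.+_) (upTo N) f) (ΣL-applyUpTo N (λ i → i) (f ∘ (lo ℕ.+_)))
    where
    N : ℕ
    N = ℕ.suc hi ∸ lo

  ΣR₀-cong : ∀ hi {f g} → (∀ i → i ≤ hi → f i ≈ g i) → ΣR 0 hi f ≈ ΣR 0 hi g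
  ΣR₀-cong hi {f} {g} f≈g = begin
    ΣR 0 hi f                         ≡⟨ ΣR-∑ 0 hi f ⟩
    ∑[ i < ℕ.suc hi ] f (toℕ i)       ≈⟨ sum-cong-≋ (λ i → f≈g (toℕ i) (ℕ.s≤s⁻¹ (toℕ<n i))) ⟩
    ∑[ i < ℕ.suc hi ] g (toℕ i)       ≡⟨ ≡.sym (ΣR-∑ 0 hi g) ⟩
    ΣR 0 hi g                         ∎

  ΣR-shift : ∀ {lo hi} → lo ≤ hi → ∀ f → ΣR lo hi f ≡ ΣR 0 (hi ∸ lo) (λ i → f (lo ℕ.+ i))
  ΣR-shift {lo} {hi} lo≤hi f =
    ≡.trans (ΣR-∑ lo hi f)
   (≡.trans (≡.cong (λ N → ∑[ i < N ] f (lo ℕ.+ toℕ i)) (ℕₚ.+-∸-assoc 1 lo≤hi))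
            (≡.sym (ΣR-∑ 0 (hi ∸ lo) _)))

  ΠF-suc : ∀ {r} (f : Fin (ℕ.suc r) → Carrier) → ΠF f ≡ f zero * ΠF (f ∘ suc)
  ΠF-suc {r} f = ≡.cong (f zero *_)
    (≡.trans (≡.cong (foldr (λ i acc → f i * acc) 1#) (≡.sym (map-tabulate (λ i → i) suc)))
             (foldr-map _ suc 1# (allFin r)))

  permAvoiding : ∀ {r c} → (Fin c → Bool) → (Fin r → Fin c → Carrier) → Carrier
  permAvoiding {ℕ.zero} A M = 1#
  permAvoiding {ℕ.suc r} {c} A M = ∑[ j < c ] (if A j then 0# else M zero j * permAvoiding (use A j) (M ∘ suc))

  permAvoiding-cong : ∀ {r c} {A B : Fin c → Bool} (M : Fin r → Fin c → Carrier) →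
                      (∀ x → A x ≡ B x) → permAvoiding A M ≈ permAvoiding B M
  permAvoiding-cong {ℕ.zero} M A≗B = refl
  permAvoiding-cong {ℕ.suc r} {A = A} {B} M A≗B = sum-cong-≋ term
    where
    term : ∀ j → (if A j then 0# else M zero j * permAvoiding (use A j) (M ∘ suc))
               ≈ (if B j then 0# else M zero j * permAvoiding (use B j) (M ∘ suc))
    term j rewrite A≗B j =
      if-cong (B j) (*-congˡ (permAvoiding-cong (M ∘ suc) (λ x → ≡.cong (does (x ≟ j) ∨_) (A≗B x))))

  module _ {r c} (A : Fin c → Bool) (M : Fin r → Fin c → Carrier) where

    weight : (Fin r → Fin c) → Carrier
    weight σ = if injectiveAvoiding A σ then ΠF (λ i → M i (σ i)) else 0#

  weight-cons : ∀ {r c} A (M : Fin (ℕ.suc r) → Fin c → Carrier) σ →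
                weight A M σ ≈ (if A (σ zero) then 0# else M zero (σ zero) * weight (use A (σ zero)) (M ∘ suc) (σ ∘ suc))
  weight-cons A M σ with A (σ zero)
  ... | true = refl
  ... | false with injectiveAvoiding (use A (σ zero)) (σ ∘ suc)
  ...   | true = reflexive (ΠF-suc (λ i → M i (σ i)))
  ...   | false = sym (zeroʳ _)

  ΣL-weight≈permAvoiding : ∀ r {c} A (M : Fin r → Fin c → Carrier) → ΣL (allFuncs r c) (weight A M) ≈ permAvoiding A M
  ΣL-weight≈permAvoiding ℕ.zero A M = +-identityʳ 1#
  ΣL-weight≈permAvoiding (ℕ.suc r) {c} A M = expand _ (λ _ _ → ≡.refl) (λ _ _ → ≡.refl)
    where
    -- `allFuncs` extends maps by an anonymous pattern lambda; abstracting over it leaves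
    -- exactly its two computation rules to work with.
    expand : (cons : Fin c → (Fin r → Fin c) → Fin (ℕ.suc r) → Fin c) →
             (∀ j σ → cons j σ zero ≡ j) → (∀ j σ → cons j σ ∘ suc ≡ σ) →
             ΣL (concatMap (λ j → map (cons j) (allFuncs r c)) (allFin c)) (weight A M) ≈ permAvoiding A M
    expand cons head tail = begin
      ΣL (concatMap (λ j → map (cons j) (allFuncs r c)) (allFin c)) (weight A M)
        ≈⟨ ΣL-concatMap _ (allFin c) (weight A M) ⟩
      ΣL (allFin c) (λ j → ΣL (map (cons j) (allFuncs r c)) (weight A M))
        ≡⟨ ΣL-tabulate {n = c} (λ j → j) _ ⟩
      ∑[ j < c ] ΣL (map (cons j) (allFuncs r c)) (weight A M)
        ≈⟨ sum-cong-≋ (λ j → trans (reflexive (ΣL-map (cons j) (allFuncs r c) (weight A M)))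
                                   (ΣL-cong (allFuncs r c) (weight-cons′ j))) ⟩
      ∑[ j < c ] ΣL (allFuncs r c) (λ σ → if A j then 0# else M zero j * weight (use A j) (M ∘ suc) σ)
        ≈⟨ sum-cong-≋ (λ j → trans (ΣL-if (allFuncs r c) (A j) _ _)
                                   (if-cong (A j) (*-congˡ (ΣL-weight≈permAvoiding r (use A j) (M ∘ suc))))) ⟩
      permAvoiding A M ∎
      where
      weight-cons′ : ∀ j σ → weight A M (cons j σ) ≈ (if A j then 0# else M zero j * weight (use A j) (M ∘ suc) σ)
      weight-cons′ j σ = ≡.subst₂ (λ k ρ → weight A M (cons j σ) ≈ (if A k then 0# else M zero k * weight (use A k) (M ∘ suc) ρ))
                                  (head j σ) (tail j σ) (weight-cons A M (cons j σ))

  perm≈permAvoiding : ∀ {r c} (M : Fin r → Fin c → Carrier) → perm M ≈ permAvoiding (λ _ → false) M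
  perm≈permAvoiding {r} {c} M = begin
    ΣL (filter injectiveFin? (allFuncs r c)) (λ σ → ΠF (λ i → M i (σ i)))
      ≈⟨ ΣL-filter injectiveFin? (allFuncs r c) _ ⟩
    ΣL (allFuncs r c) (λ σ → if does (injectiveFin? σ) then ΠF (λ i → M i (σ i)) else 0#)
      ≈⟨ ΣL-cong (allFuncs r c) (λ σ → reflexive (≡.cong (λ b → if b then ΠF (λ i → M i (σ i)) else 0#) (does-injectiveFin? σ))) ⟩
    ΣL (allFuncs r c) (weight (λ _ → false) M)
      ≈⟨ ΣL-weight≈permAvoiding r _ M ⟩
    permAvoiding (λ _ → false) M ∎

  ∑-free : ∀ {c} (A : Fin c → Bool) x → ∑[ j < c ] (if A j then 0# else x) ≈ #free A ·ₙ x
  ∑-free {ℕ.zero} A x = refl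
  ∑-free {ℕ.suc c} A x with A zero
  ... | true = trans (+-identityˡ _) (∑-free (A ∘ suc) x)
  ... | false = +-congˡ (∑-free (A ∘ suc) x)

  -- Each injection of the r rows into the free columns, together with one further free column,
  -- is counted once on the left; that column can be chosen in #free A ∸ r ways. Inductively:
  -- exchange the extra column with the column of the first row.
  ∑-permAvoiding-use : ∀ r {c} (A : Fin c → Bool) (N : Fin r → Fin c → Carrier) →
    ∑[ j < c ] (if A j then 0# else permAvoiding (use A j) N) ≈ (#free A ∸ r) ·ₙ permAvoiding A N
  ∑-permAvoiding-use ℕ.zero A N = ∑-free A 1#
  ∑-permAvoiding-use (ℕ.suc r) {c} A N = begin
    ∑[ j < c ] (if A j then 0# else ∑[ j' < c ] (if use A j j' then 0# else N zero j' * G (use (use A j) j')))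
      ≈⟨ sum-cong-≋ (λ j → trans (sym (∑-if {c} (A j) _)) (sum-cong-≋ (reorder j))) ⟩
    ∑[ j < c ] ∑[ j' < c ] T j j'
      ≈⟨ ∑-comm T ⟩
    ∑[ j' < c ] ∑[ j < c ] T j j'
      ≈⟨ sum-cong-≋ (λ j' → trans (∑-if {c} (A j') _) (if-cong (A j') (sym (*-distribˡ-sum {c} (N zero j') _)))) ⟩
    ∑[ j' < c ] (if A j' then 0# else N zero j' * ∑[ j < c ] (if use A j' j then 0# else G (use (use A j') j)))
      ≈⟨ sum-cong-≋ (λ j' → innerSum j') ⟩
    ∑[ j' < c ] ((#free A ∸ ℕ.suc r) ·ₙ (if A j' then 0# else N zero j' * G (use A j')))
      ≈⟨ sym (×-distrib-sum {c} (#free A ∸ ℕ.suc r) _) ⟩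
    (#free A ∸ ℕ.suc r) ·ₙ permAvoiding A N ∎
    where
    G : (Fin c → Bool) → Carrier
    G B = permAvoiding B (N ∘ suc)
    T : Fin c → Fin c → Carrier
    T j j' = if A j' then 0# else N zero j' * (if use A j' j then 0# else G (use (use A j') j))

    reorder : ∀ j j' → (if A j then 0# else (if use A j j' then 0# else N zero j' * G (use (use A j) j'))) ≈ T j j'
    reorder j j' with j ≟ j'
    ... | yes ≡.refl rewrite use-self A j with A j
    ...   | true = refl
    ...   | false = sym (zeroʳ _)
    reorder j j' | no j≢j' rewrite use-other A (j≢j' ∘ ≡.sym) with A j | A j'
    ... | true | true = refl
    ... | true | false = sym (zeroʳ _)
    ... | false | true = refl
    ... | false | false = *-congˡ (permAvoiding-cong (N ∘ suc) (use-comm A j j'))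

    innerSum : ∀ j' → (if A j' then 0# else N zero j' * ∑[ j < c ] (if use A j' j then 0# else G (use (use A j') j)))
                          ≈ (#free A ∸ ℕ.suc r) ·ₙ (if A j' then 0# else N zero j' * G (use A j'))
    innerSum j' with A j' in e
    ... | true = sym (×-zeroʳ (#free A ∸ ℕ.suc r))
    ... | false = begin
      N zero j' * ∑[ j < c ] (if use A j' j then 0# else G (use (use A j') j))
        ≈⟨ *-congˡ (∑-permAvoiding-use r (use A j') (N ∘ suc)) ⟩
      N zero j' * ((#free (use A j') ∸ r) ·ₙ G (use A j'))
        ≡⟨ ≡.cong (λ m → N zero j' * ((m ∸ ℕ.suc r) ·ₙ G (use A j'))) (≡.sym (#free-use A j' e)) ⟩
      N zero j' * ((#free A ∸ ℕ.suc r) ·ₙ G (use A j'))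
        ≈⟨ ×-comm-* (#free A ∸ ℕ.suc r) (N zero j') _ ⟩
      (#free A ∸ ℕ.suc r) ·ₙ (N zero j' * G (use A j')) ∎

  ΣR₀-delta : ∀ {K d} → d ≤ K → ∀ f → (∀ k → k ≢ d → f k ≈ 0#) → ΣR 0 K f ≈ f d
  ΣR₀-delta {K} {d} d≤K f f≈0 = begin
    ΣR 0 K f                      ≡⟨ ΣR-∑ 0 K f ⟩
    ∑[ k < ℕ.suc K ] f (toℕ k)    ≈⟨ ∑-delta (f ∘ toℕ) d′ (λ k k≢d′ → f≈0 (toℕ k) (k≢d′ ∘ toℕ≡d⇒≡d′)) ⟩
    f (toℕ d′)                    ≡⟨ ≡.cong f (toℕ-fromℕ< (ℕ.s≤s d≤K)) ⟩
    f d                           ∎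
    where
    d′ : Fin (ℕ.suc K)
    d′ = fromℕ< (ℕ.s≤s d≤K)
    toℕ≡d⇒≡d′ : ∀ {k} → toℕ k ≡ d → k ≡ d′
    toℕ≡d⇒≡d′ eq = toℕ-injective (≡.trans eq (≡.sym (toℕ-fromℕ< (ℕ.s≤s d≤K))))

  lincomb-JS : ∀ {n ℓ} K (c : ℕ → Carrier) (S T : LSub n ℓ) → dist (proj₁ S) (proj₁ T) ≤ K →
               lincomb K c (JS n ℓ) S T ≈ c (dist (proj₁ S) (proj₁ T))
  lincomb-JS {n} {ℓ} K c S′@(S , _) T′@(T , _) d≤K = begin
    lincomb K c (JS n ℓ) S′ T′    ≈⟨ ΣR₀-delta d≤K (λ k → c k * JS n ℓ k S′ T′) (λ k k≢d → trans (*-congˡ (JS-off k≢d)) (zeroʳ (c k))) ⟩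
    c d * JS n ℓ d S′ T′          ≈⟨ trans (*-congˡ JS-on) (*-identityʳ (c d)) ⟩
    c d                           ∎
    where
    d : ℕ
    d = dist S T
    JS-on : JS n ℓ d S′ T′ ≈ 1#
    JS-on with dist S T ℕ.≟ d
    ... | yes _ = refl
    ... | no d≢d = ⊥-elim (d≢d ≡.refl)
    JS-off : ∀ {k} → k ≢ d → JS n ℓ k S′ T′ ≈ 0#
    JS-off {k} k≢d with dist S T ℕ.≟ k
    ... | yes d≡k = ⊥-elim (k≢d (≡.sym d≡k))
    ... | no _ = refl

  lincomb-cong : ∀ {n ℓ} K {c c′ : ℕ → Carrier} (M : ℕ → LSub n ℓ → LSub n ℓ → Carrier) →
                 (∀ k → k ≤ K → c k ≈ c′ k) → lincomb K c M ≋ lincomb K c′ M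
  lincomb-cong K M c≈c′ S T = ΣR₀-cong K (λ k k≤K → *-congʳ (c≈c′ k k≤K))

  idM-diag : ∀ {n} (x : Fin n) → idM x x ≈ 1#
  idM-diag x with x ≟ x
  ... | yes _ = refl
  ... | no x≢x = ⊥-elim (x≢x ≡.refl)

  idM-offDiag : ∀ {n} {x x' : Fin n} → x ≢ x' → idM x x' ≈ 0#
  idM-offDiag {x = x} {x'} x≢x' with x ≟ x'
  ... | yes x≡x' = ⊥-elim (x≢x' x≡x')
  ... | no _ = refl

  module _ (s t : Carrier) where

    closedPermTerm : ℕ → ℕ → ℕ → ℕ → Carrier
    closedPermTerm r m p q = ((p C q) ℕ.* ((m ∸ q) P′ (r ∸ q))) ·ₙ (s ^ q * t ^ (r ∸ q))

    closedPerm : ℕ → ℕ → ℕ → Carrier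
    closedPerm r m p = ∑[ q < ℕ.suc p ] closedPermTerm r m p (toℕ q)

    closedPermTerm-unmatched : ∀ {r q} m p → q ≤ r →
                               closedPermTerm (ℕ.suc r) m p q ≈ t * ((m ∸ r) ·ₙ closedPermTerm r m p q)
    closedPermTerm-unmatched {r} {q} m p q≤r = begin
      ((p C q) ℕ.* ((m ∸ q) P′ (ℕ.suc r ∸ q))) ·ₙ (s ^ q * t ^ (ℕ.suc r ∸ q))
        ≡⟨ ≡.cong (λ e → ((p C q) ℕ.* ((m ∸ q) P′ e)) ·ₙ (s ^ q * t ^ e)) (ℕₚ.+-∸-assoc 1 q≤r) ⟩
      ((p C q) ℕ.* (((m ∸ q) ∸ (r ∸ q)) ℕ.* P)) ·ₙ (s ^ q * (t * t ^ (r ∸ q)))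
        ≡⟨ ≡.cong (λ e → ((p C q) ℕ.* (e ℕ.* P)) ·ₙ (s ^ q * (t * t ^ (r ∸ q)))) ([m∸n]∸[o∸n]≡m∸o m q≤r) ⟩
      ((p C q) ℕ.* ((m ∸ r) ℕ.* P)) ·ₙ (s ^ q * (t * t ^ (r ∸ q)))
        ≡⟨ ≡.cong (_·ₙ (s ^ q * (t * t ^ (r ∸ q)))) (ℕ*.x∙yz≈y∙xz (p C q) (m ∸ r) P) ⟩
      ((m ∸ r) ℕ.* ((p C q) ℕ.* P)) ·ₙ (s ^ q * (t * t ^ (r ∸ q)))
        ≈⟨ sym (×-assocˡ (s ^ q * (t * t ^ (r ∸ q))) (m ∸ r) ((p C q) ℕ.* P)) ⟩
      (m ∸ r) ·ₙ (((p C q) ℕ.* P) ·ₙ (s ^ q * (t * t ^ (r ∸ q))))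
        ≈⟨ ×-congʳ (m ∸ r) (×-congʳ ((p C q) ℕ.* P) (R*.x∙yz≈y∙xz (s ^ q) t _)) ⟩
      (m ∸ r) ·ₙ (((p C q) ℕ.* P) ·ₙ (t * (s ^ q * t ^ (r ∸ q))))
        ≈⟨ ×-congʳ (m ∸ r) (sym (×-comm-* ((p C q) ℕ.* P) t (s ^ q * t ^ (r ∸ q)))) ⟩
      (m ∸ r) ·ₙ (t * closedPermTerm r m p q)
        ≈⟨ sym (×-comm-* (m ∸ r) t _) ⟩
      t * ((m ∸ r) ·ₙ closedPermTerm r m p q) ∎
      where
      P : ℕ
      P = (m ∸ q) P′ (r ∸ q)

    closedPerm-unmatched : ∀ {r p} m → p ≤ r → closedPerm (ℕ.suc r) m p ≈ t * ((m ∸ r) ·ₙ closedPerm r m p)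
    closedPerm-unmatched {r} {p} m p≤r = begin
      ∑[ q < ℕ.suc p ] closedPermTerm (ℕ.suc r) m p (toℕ q)
        ≈⟨ sum-cong-≋ (λ q → closedPermTerm-unmatched m p (ℕₚ.≤-trans (ℕ.s≤s⁻¹ (toℕ<n q)) p≤r)) ⟩
      ∑[ q < ℕ.suc p ] (t * ((m ∸ r) ·ₙ closedPermTerm r m p (toℕ q)))
        ≈⟨ sym (*-distribˡ-sum {ℕ.suc p} t (λ q → (m ∸ r) ·ₙ closedPermTerm r m p (toℕ q))) ⟩
      t * ∑[ q < ℕ.suc p ] ((m ∸ r) ·ₙ closedPermTerm r m p (toℕ q))
        ≈⟨ *-congˡ (sym (×-distrib-sum {ℕ.suc p} (m ∸ r) (λ q → closedPermTerm r m p (toℕ q)))) ⟩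
      t * ((m ∸ r) ·ₙ closedPerm r m p) ∎

    closedPermTerm-pascal : ∀ r m p q → closedPermTerm (ℕ.suc r) (ℕ.suc m) (ℕ.suc p) (ℕ.suc q)
                            ≈ s * closedPermTerm r m p q + closedPermTerm (ℕ.suc r) (ℕ.suc m) p (ℕ.suc q)
    closedPermTerm-pascal r m p q = begin
      ((ℕ.suc p C ℕ.suc q) ℕ.* P) ·ₙ W
        ≡⟨ ≡.cong (λ k → (k ℕ.* P) ·ₙ W) (≡.sym (nCk+nC[k+1]≡[n+1]C[k+1] p q)) ⟩
      ((p C q ℕ.+ p C ℕ.suc q) ℕ.* P) ·ₙ W
        ≡⟨ ≡.cong (_·ₙ W) (ℕₚ.*-distribʳ-+ P (p C q) (p C ℕ.suc q)) ⟩
      ((p C q) ℕ.* P ℕ.+ (p C ℕ.suc q) ℕ.* P) ·ₙ W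
        ≈⟨ ×-homo-+ W ((p C q) ℕ.* P) ((p C ℕ.suc q) ℕ.* P) ⟩
      ((p C q) ℕ.* P) ·ₙ ((s * s ^ q) * t ^ (r ∸ q)) + ((p C ℕ.suc q) ℕ.* P) ·ₙ W
        ≈⟨ +-congʳ (×-congʳ ((p C q) ℕ.* P) (*-assoc s (s ^ q) (t ^ (r ∸ q)))) ⟩
      ((p C q) ℕ.* P) ·ₙ (s * (s ^ q * t ^ (r ∸ q))) + ((p C ℕ.suc q) ℕ.* P) ·ₙ W
        ≈⟨ +-congʳ (sym (×-comm-* ((p C q) ℕ.* P) s (s ^ q * t ^ (r ∸ q)))) ⟩
      s * closedPermTerm r m p q + closedPermTerm (ℕ.suc r) (ℕ.suc m) p (ℕ.suc q) ∎
      where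
      P : ℕ
      P = (m ∸ q) P′ (r ∸ q)
      W : Carrier
      W = s ^ ℕ.suc q * t ^ (r ∸ q)

    closedPerm-extend : ∀ r m p → closedPerm r m p ≈ ∑[ q < ℕ.suc (ℕ.suc p) ] closedPermTerm r m p (toℕ q)
    closedPerm-extend r m p = sym (begin
      ∑[ q < ℕ.suc (ℕ.suc p) ] closedPermTerm r m p (toℕ q)
        ≈⟨ sum-init-last {ℕ.suc p} (λ q → closedPermTerm r m p (toℕ q)) ⟩
      ∑[ q < ℕ.suc p ] closedPermTerm r m p (toℕ (inject₁ q)) + closedPermTerm r m p (toℕ (fromℕ (ℕ.suc p)))
        ≈⟨ +-cong (sum-cong-≋ {ℕ.suc p} (λ q → reflexive (≡.cong (closedPermTerm r m p) (toℕ-inject₁ q))))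
                  (reflexive (≡.cong (closedPermTerm r m p) (toℕ-fromℕ (ℕ.suc p)))) ⟩
      closedPerm r m p + closedPermTerm r m p (ℕ.suc p)
        ≡⟨ ≡.cong (λ k → closedPerm r m p + (k ℕ.* ((m ∸ ℕ.suc p) P′ (r ∸ ℕ.suc p))) ·ₙ (s ^ ℕ.suc p * t ^ (r ∸ ℕ.suc p))) (k>n⇒nCk≡0 (ℕₚ.n<1+n p)) ⟩
      closedPerm r m p + 0#
        ≈⟨ +-identityʳ _ ⟩
      closedPerm r m p ∎)

    closedPerm-matched : ∀ {r p} m → p ≤ r →
      closedPerm (ℕ.suc r) (ℕ.suc m) (ℕ.suc p) ≈ t * ((ℕ.suc m ∸ r) ·ₙ closedPerm r (ℕ.suc m) p) + s * closedPerm r m p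
    closedPerm-matched {r} {p} m p≤r = begin
      X (ℕ.suc p) 0 + ∑[ q < ℕ.suc p ] X (ℕ.suc p) (ℕ.suc (toℕ q))
        ≈⟨ +-congˡ (sum-cong-≋ {ℕ.suc p} (λ q → closedPermTerm-pascal r m p (toℕ q))) ⟩
      X p 0 + ∑[ q < ℕ.suc p ] (s * closedPermTerm r m p (toℕ q) + X p (ℕ.suc (toℕ q)))
        ≈⟨ +-congˡ (∑-distrib-+ {ℕ.suc p} (λ q → s * closedPermTerm r m p (toℕ q)) (λ q → X p (ℕ.suc (toℕ q)))) ⟩
      X p 0 + (∑[ q < ℕ.suc p ] (s * closedPermTerm r m p (toℕ q)) + ∑[ q < ℕ.suc p ] X p (ℕ.suc (toℕ q)))
        ≈⟨ R+.x∙yz≈xz∙y (X p 0) _ _ ⟩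
      ∑[ q < ℕ.suc (ℕ.suc p) ] X p (toℕ q) + ∑[ q < ℕ.suc p ] (s * closedPermTerm r m p (toℕ q))
        ≈⟨ +-cong (sym (closedPerm-extend (ℕ.suc r) (ℕ.suc m) p))
                  (sym (*-distribˡ-sum {ℕ.suc p} s (λ q → closedPermTerm r m p (toℕ q)))) ⟩
      closedPerm (ℕ.suc r) (ℕ.suc m) p + s * closedPerm r m p
        ≈⟨ +-congʳ (closedPerm-unmatched (ℕ.suc m) p≤r) ⟩
      t * ((ℕ.suc m ∸ r) ·ₙ closedPerm r (ℕ.suc m) p) + s * closedPerm r m p ∎
      where
      X : ℕ → ℕ → Carrier
      X = closedPermTerm (ℕ.suc r) (ℕ.suc m)

    closedPerm≈h : ∀ {ℓ k} → k ≤ ℓ → closedPerm ℓ ℓ (ℓ ∸ k) ≈ h (ℓ ∸ k) k s t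
    closedPerm≈h {ℓ} {k} k≤ℓ = begin
      closedPerm ℓ ℓ p
        ≈⟨ ∑-permute {ℕ.suc p} (λ q → closedPermTerm ℓ ℓ p (toℕ q)) reverse ⟩
      ∑[ i < ℕ.suc p ] closedPermTerm ℓ ℓ p (toℕ (opposite i))
        ≈⟨ sum-cong-≋ {ℕ.suc p} (λ i → reflexive (term i)) ⟩
      ∑[ i < ℕ.suc p ] hTerm (toℕ i)
        ≡⟨ ≡.sym (ΣR-∑ 0 p hTerm) ⟩
      h p k s t ∎
      where
      p : ℕ
      p = ℓ ∸ k
      hTerm : ℕ → Carrier
      hTerm j = ((p C j) ℕ.* ((k ℕ.+ j) !)) ·ₙ (s ^ (p ∸ j) * t ^ (k ℕ.+ j))
      term : ∀ i → closedPermTerm ℓ ℓ p (toℕ (opposite i)) ≡ hTerm (toℕ i)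
      term i rewrite opposite-prop i
                   | m∸[m∸n∸o]≡n+o k≤ℓ (ℕ.s≤s⁻¹ (toℕ<n i))
                   | nP′n≡n! (k ℕ.+ toℕ i)
                   | ≡.sym (nCk≡nC[n∸k] (ℕ.s≤s⁻¹ (toℕ<n i))) = ≡.refl

    JS-coefficient≈h : ∀ {ℓ k} → k ≤ ℓ →
      ΣR k ℓ (λ j → (((ℓ ∸ k) C (ℓ ∸ j)) ℕ.* (j !)) ·ₙ (s ^ (ℓ ∸ j) * t ^ j)) ≈ h (ℓ ∸ k) k s t
    JS-coefficient≈h {ℓ} {k} k≤ℓ = begin
      ΣR k ℓ (λ j → ((p C (ℓ ∸ j)) ℕ.* (j !)) ·ₙ (s ^ (ℓ ∸ j) * t ^ j))
        ≡⟨ ΣR-shift k≤ℓ _ ⟩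
      ΣR 0 p (λ i → ((p C (ℓ ∸ (k ℕ.+ i))) ℕ.* ((k ℕ.+ i) !)) ·ₙ (s ^ (ℓ ∸ (k ℕ.+ i)) * t ^ (k ℕ.+ i)))
        ≈⟨ ΣR₀-cong p (λ i i≤p → reflexive (term i i≤p)) ⟩
      h p k s t ∎
      where
      p : ℕ
      p = ℓ ∸ k
      term : ∀ i → i ≤ p → ((p C (ℓ ∸ (k ℕ.+ i))) ℕ.* ((k ℕ.+ i) !)) ·ₙ (s ^ (ℓ ∸ (k ℕ.+ i)) * t ^ (k ℕ.+ i))
                          ≡ ((p C i) ℕ.* ((k ℕ.+ i) !)) ·ₙ (s ^ (p ∸ i) * t ^ (k ℕ.+ i))
      term i i≤p rewrite ≡.sym (ℕₚ.∸-+-assoc ℓ k i) | ≡.sym (nCk≡nC[n∸k] i≤p) = ≡.refl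

    split-sI+tJ : ∀ b d g → (if b then 0# else (s * d + t * 1#) * g)
                            ≈ t * (if b then 0# else g) + s * (if b then 0# else d * g)
    split-sI+tJ true d g = sym (trans (+-cong (zeroʳ t) (zeroʳ s)) (+-identityʳ 0#))
    split-sI+tJ false d g = begin
      (s * d + t * 1#) * g        ≈⟨ distribʳ g (s * d) (t * 1#) ⟩
      s * d * g + t * 1# * g      ≈⟨ +-comm _ _ ⟩
      t * 1# * g + s * d * g      ≈⟨ +-cong (*-congʳ (*-identityʳ t)) (*-assoc s d g) ⟩
      t * g + s * (d * g)         ∎

    rows : ∀ {n c} → (Fin c → Fin n) → (xs : List (Fin n)) → Fin (length xs) → Fin c → Carrier
    rows y xs i j = s * idM (lookup xs i) (y j) + t * onesM (lookup xs i) (y j)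

    module _ {n c} (y : Fin c → Fin n) (y-injective : ∀ {j j'} → y j ≡ y j' → j ≡ j') where

      permAvoiding-rows≈closedPerm : ∀ xs → Unique xs → ∀ A →
        permAvoiding A (rows y xs) ≈ closedPerm (length xs) (#free A) (#matched y A xs)
      permAvoiding-rows≈closedPerm [] [] A = sym (trans (+-identityʳ _) (trans (+-identityʳ _) (*-identityˡ 1#)))
      permAvoiding-rows≈closedPerm (x ∷ xs) (x∉xs ∷ xs-unique) A = begin
        ∑[ j < c ] (if A j then 0# else (s * idM x (y j) + t * 1#) * G (use A j))
          ≈⟨ sum-cong-≋ (λ j → split-sI+tJ (A j) (idM x (y j)) (G (use A j))) ⟩
        ∑[ j < c ] (t * (if A j then 0# else G (use A j)) + s * diagonal j)
          ≈⟨ ∑-distrib-+ {c} (λ j → t * (if A j then 0# else G (use A j))) (λ j → s * diagonal j) ⟩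
        ∑[ j < c ] (t * (if A j then 0# else G (use A j))) + ∑[ j < c ] (s * diagonal j)
          ≈⟨ +-cong (sym (*-distribˡ-sum {c} t _)) (sym (*-distribˡ-sum {c} s diagonal)) ⟩
        t * ∑[ j < c ] (if A j then 0# else G (use A j)) + s * sum diagonal
          ≈⟨ +-congʳ (*-congˡ (∑-permAvoiding-use r A (rows y xs))) ⟩
        t * ((#free A ∸ r) ·ₙ G A) + s * sum diagonal
          ≈⟨ +-congʳ (*-congˡ (×-congʳ (#free A ∸ r) (permAvoiding-rows≈closedPerm xs xs-unique A))) ⟩
        t * ((#free A ∸ r) ·ₙ closedPerm r (#free A) p) + s * sum diagonal
          ≈⟨ firstRow (matched? y A x) ⟩
        closedPerm (ℕ.suc r) (#free A) (#matched y A (x ∷ xs)) ∎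
        where
        r : ℕ
        r = length xs
        G : (Fin c → Bool) → Carrier
        G B = permAvoiding B (rows y xs)
        diagonal : Fin c → Carrier
        diagonal j = if A j then 0# else idM x (y j) * G (use A j)
        p : ℕ
        p = #matched y A xs
        p≤r : p ≤ r
        p≤r = length-filter (matched? y A) xs

        firstRow : Dec (Matched y A x) →
                   t * ((#free A ∸ r) ·ₙ closedPerm r (#free A) p) + s * sum diagonal
                   ≈ closedPerm (ℕ.suc r) (#free A) (#matched y A (x ∷ xs))
        firstRow (no unmatched) = begin
          t * ((#free A ∸ r) ·ₙ closedPerm r (#free A) p) + s * sum diagonal
            ≈⟨ +-congˡ (trans (*-congˡ (∑-zero diagonal vanish)) (zeroʳ s)) ⟩
          t * ((#free A ∸ r) ·ₙ closedPerm r (#free A) p) + 0#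
            ≈⟨ +-identityʳ _ ⟩
          t * ((#free A ∸ r) ·ₙ closedPerm r (#free A) p)
            ≈⟨ sym (closedPerm-unmatched (#free A) p≤r) ⟩
          closedPerm (ℕ.suc r) (#free A) p
            ≡⟨ ≡.cong (closedPerm (ℕ.suc r) (#free A) ∘ length) (≡.sym (filter-reject (matched? y A) unmatched)) ⟩
          closedPerm (ℕ.suc r) (#free A) (#matched y A (x ∷ xs)) ∎
          where
          vanish : ∀ j → diagonal j ≈ 0#
          vanish j with A j in free
          ... | true = refl
          ... | false = trans (*-congʳ (idM-offDiag (λ x≡yj → unmatched (j , free , x≡yj)))) (zeroˡ _)
        firstRow (yes (j₀ , free , x≡yj₀)) = begin
          t * ((#free A ∸ r) ·ₙ closedPerm r (#free A) p) + s * sum diagonal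
            ≈⟨ +-congˡ (*-congˡ selected) ⟩
          t * ((#free A ∸ r) ·ₙ closedPerm r (#free A) p) + s * closedPerm r m p
            ≡⟨ ≡.cong (λ m' → t * ((m' ∸ r) ·ₙ closedPerm r m' p) + s * closedPerm r m p) (#free-use A j₀ free) ⟩
          t * ((ℕ.suc m ∸ r) ·ₙ closedPerm r (ℕ.suc m) p) + s * closedPerm r m p
            ≈⟨ sym (closedPerm-matched m p≤r) ⟩
          closedPerm (ℕ.suc r) (ℕ.suc m) (ℕ.suc p)
            ≡⟨ ≡.cong₂ (closedPerm (ℕ.suc r)) (≡.sym (#free-use A j₀ free))
                       (≡.cong length (≡.sym (filter-accept (matched? y A) (j₀ , free , x≡yj₀)))) ⟩
          closedPerm (ℕ.suc r) (#free A) (#matched y A (x ∷ xs)) ∎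
          where
          m : ℕ
          m = #free (use A j₀)
          others : ∀ j → j ≢ j₀ → diagonal j ≈ 0#
          others j j≢j₀ with A j
          ... | true = refl
          ... | false = trans (*-congʳ (idM-offDiag (λ x≡yj → j≢j₀ (y-injective (≡.trans (≡.sym x≡yj) x≡yj₀))))) (zeroˡ _)
          selected : sum diagonal ≈ closedPerm r m p
          selected = begin
            sum diagonal
              ≈⟨ ∑-delta diagonal j₀ others ⟩
            diagonal j₀
              ≡⟨ ≡.cong (λ b → if b then 0# else idM x (y j₀) * G (use A j₀)) free ⟩
            idM x (y j₀) * G (use A j₀)
              ≈⟨ trans (*-congʳ (trans (reflexive (≡.cong (idM x) (≡.sym x≡yj₀))) (idM-diag x))) (*-identityˡ _) ⟩
            G (use A j₀)
              ≈⟨ permAvoiding-rows≈closedPerm xs xs-unique (use A j₀) ⟩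
            closedPerm r m (#matched y (use A j₀) xs)
              ≡⟨ ≡.cong (closedPerm r m) (#matched-use y xs x≡yj₀ x∉xs) ⟩
            closedPerm r m p ∎

    compound-sI+tJ : ∀ {n ℓ} (S T : LSub n ℓ) → let d = dist (proj₁ S) (proj₁ T) in
                     compound ℓ (λ i j → s * idM i j + t * onesM i j) S T ≈ h (ℓ ∸ d) d s t
    compound-sI+tJ {n} {ℓ} (S , ∣S∣≡ℓ) (T , ∣T∣≡ℓ) = begin
      perm (rows y (members S))
        ≈⟨ perm≈permAvoiding (rows y (members S)) ⟩
      permAvoiding (λ _ → false) (rows y (members S))
        ≈⟨ permAvoiding-rows≈closedPerm y (Unique⇒lookup-injective (members-unique T)) (members S) (members-unique S) (λ _ → false) ⟩
      closedPerm (length (members S)) (#free {length (members T)} (λ _ → false)) (#matched y (λ _ → false) (members S))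
        ≡⟨ ≡.cong₂ (λ r m → closedPerm r m (#matched y (λ _ → false) (members S))) (≡.trans (length-members S) ∣S∣≡ℓ)
                   (≡.trans (#free-none _) (≡.trans (length-members T) ∣T∣≡ℓ)) ⟩
      closedPerm ℓ ℓ (#matched y (λ _ → false) (members S))
        ≡⟨ ≡.cong (closedPerm ℓ ℓ) (≡.trans (≡.sym (ℕₚ.m+n∸n≡m _ d)) (≡.cong (_∸ d) matched+d≡ℓ)) ⟩
      closedPerm ℓ ℓ (ℓ ∸ d)
        ≈⟨ closedPerm≈h (≡.subst (d ≤_) matched+d≡ℓ (ℕₚ.m≤n+m d _)) ⟩
      h (ℓ ∸ d) d s t ∎
      where
      y : Fin (length (members T)) → Fin n
      y = lookup (members T)
      d : ℕ
      d = dist S T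
      matched+d≡ℓ : #matched y (λ _ → false) (members S) ℕ.+ d ≡ ℓ
      matched+d≡ℓ = ≡.trans (#matched-members S T) ∣S∣≡ℓ

    compound-sI+tJ≋lincomb : ∀ {n ℓ} → compound ℓ (λ i j → s * idM i j + t * onesM i j)
                                       ≋ lincomb (ℓ ⊓ (n ∸ ℓ)) (λ k → h (ℓ ∸ k) k s t) (JS n ℓ)
    compound-sI+tJ≋lincomb {n} {ℓ} S T =
      trans (compound-sI+tJ S T) (sym (lincomb-JS (ℓ ⊓ (n ∸ ℓ)) _ S T (dist≤ℓ⊓[n∸ℓ] S T)))

    JS-coefficients≋h : ∀ {n ℓ} →
      lincomb (ℓ ⊓ (n ∸ ℓ)) (λ k → ΣR k ℓ (λ j → (((ℓ ∸ k) C (ℓ ∸ j)) ℕ.* (j !)) ·ₙ (s ^ (ℓ ∸ j) * t ^ j))) (JS n ℓ)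
      ≋ lincomb (ℓ ⊓ (n ∸ ℓ)) (λ k → h (ℓ ∸ k) k s t) (JS n ℓ)
    JS-coefficients≋h {n} {ℓ} = lincomb-cong (ℓ ⊓ (n ∸ ℓ)) (JS n ℓ)
      (λ k k≤K → JS-coefficient≈h (ℕₚ.≤-trans k≤K (ℕₚ.m⊓n≤m ℓ (n ∸ ℓ))))

theorem4p1 : ∀ {a r : Level} (R : CommutativeRing a r) → let open Mat R in
    (n ℓ : ℕ) → 1 ≤ ℓ → ℓ ≤ n → (s t : Carrier) →
    (compound ℓ (λ i j → s * idM i j + t * onesM i j)
       ≋ lincomb (ℓ ⊓ (n ∸ ℓ))
           (λ k → ΣR k ℓ (λ j → (((ℓ ∸ k) C (ℓ ∸ j)) Data.Nat.* (j !)) ·ₙ ((s ^ (ℓ ∸ j)) * (t ^ j))))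
           (JS n ℓ))
    ×
    (lincomb (ℓ ⊓ (n ∸ ℓ))
           (λ k → ΣR k ℓ (λ j → (((ℓ ∸ k) C (ℓ ∸ j)) Data.Nat.* (j !)) ·ₙ ((s ^ (ℓ ∸ j)) * (t ^ j))))
           (JS n ℓ)
       ≋ lincomb (ℓ ⊓ (n ∸ ℓ)) (λ k → h (ℓ ∸ k) k s t) (JS n ℓ))
theorem4p1 R n ℓ _ _ s t =
  (λ S T → trans (compound-sI+tJ≋lincomb R s t S T) (sym (JS-coefficients≋h R s t S T))) ,
  JS-coefficients≋h R s t
  where open CommutativeRing R using (trans; sym)
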